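{- Let $q=p^h$ with $p$ an odd prime and $h\geq1$. In $\mathrm{PG}(3,q)$ with homogeneous coordinates $(X_0,X_1,X_2,X_3)$, let $\pi_\infty$ be the plane $X_3=0$ and let $\mathcal{C}$ be a conic in $\pi_\infty$. Let $U=\{(a_i,b_i,c_i,1): i=1,\dots,q^2-2\}$ be a set of $q^2-2$ points of $\mathrm{PG}(3,q)\setminus\pi_\infty$ such that no line joining two distinct points of $U$ meets $\pi_\infty$ in a point of $\mathcal{C}$. Define $$R(X,Y,Z,W)=\prod_{i=1}^{q^2-2}(X+a_iY+b_iZ+c_iW)\in\mathbb{F}_q[X,Y,Z,W].$$ For $(y,z,w)\in\mathbb{F}_q^3\setminus\{(0,0,0)\}$ let $l(y,z,w)$ be the line of $\pi_\infty$ with equation $yX_0+zX_1+wX_2=0$. If $l(y,z,w)$ meets $\mathcal{C}$ in at least one point, then $R(X,y,z,w)$ divides $(X^q-X)^q$ in $\mathbb{F}_q[X]$. -}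

module Defs where

open import Level using (_⊔_)
open import Algebra.Bundles using (CommutativeRing)
open import Data.Nat using (ℕ; zero; suc)
open import Data.Fin using (Fin)
open import Data.List using (List; []; _∷_; map)
open import Data.Product using (Σ; ∃; _×_)
open import Relation.Binary.PropositionalEquality using (_≡_)
open import Relation.Nullary using (¬_)

module Over {c ℓ} (R : CommutativeRing c ℓ) where
  open CommutativeRing R public

  record IsField : Set (c ⊔ ℓ) where
    field
      1≉0 : ¬ (1# ≈ 0#)
      inverse : ∀ x → ¬ (x ≈ 0#) → ∃ λ y → x * y ≈ 1#

  record HasSize (q : ℕ) : Set (c ⊔ ℓ) where
    field
      enum : Fin q → Carrier
      enum-injective : ∀ i j → enum i ≈ enum j → i ≡ j
      enum-surjective : ∀ x → ∃ λ i → enum i ≈ x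

  -- Univariate polynomials R[X]: coefficient lists, lowest degree first
  infixl 6 _+P_ _-P_
  infixl 7 _*P_
  infixr 8 _^P_
  infix 4 _≈P_ _∣P_

  Pol : Set c
  Pol = List Carrier

  coeff : Pol → ℕ → Carrier
  coeff [] n = 0#
  coeff (a ∷ f) zero = a
  coeff (a ∷ f) (suc n) = coeff f n

  _≈P_ : Pol → Pol → Set ℓ
  f ≈P g = ∀ n → coeff f n ≈ coeff g n

  _+P_ : Pol → Pol → Pol
  [] +P g = g
  (a ∷ f) +P [] = a ∷ f
  (a ∷ f) +P (b ∷ g) = (a + b) ∷ (f +P g)

  scaleP : Carrier → Pol → Pol
  scaleP a = map (a *_)

  negP : Pol → Pol
  negP = map (-_)

  _-P_ : Pol → Pol → Pol
  f -P g = f +P negP g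

  _*P_ : Pol → Pol → Pol
  [] *P g = []
  (a ∷ f) *P g = scaleP a g +P (0# ∷ (f *P g))

  oneP : Pol
  oneP = 1# ∷ []

  XP : Pol
  XP = 0# ∷ 1# ∷ []

  _^P_ : Pol → ℕ → Pol
  f ^P zero = oneP
  f ^P suc n = f *P (f ^P n)

  _∣P_ : Pol → Pol → Set (c ⊔ ℓ)
  f ∣P g = Σ Pol λ k → (f *P k) ≈P g

  ∏P : (n : ℕ) → (Fin n → Pol) → Pol
  ∏P zero f = oneP
  ∏P (suc n) f = f Fin.zero *P ∏P n (λ i → f (Fin.suc i))
    where import Data.Fin as Fin

  -- Conics in the plane π∞ : X₃ = 0 of PG(3,q)
  -- A conic is given by a quadratic form
  --   Q(x) = xᵀ A x,  A = [[a00,a01,a02],[a01,a11,a12],[a02,a12,a22]]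
  -- with det A ≠ 0 (non-degenerate conic; q odd, so every quadratic form
  -- has this shape).
  record Conic : Set (c ⊔ ℓ) where
    field
      a00 a11 a22 a01 a02 a12 : Carrier
    det : Carrier
    det = a00 * (a11 * a22 - a12 * a12)
          - a01 * (a01 * a22 - a12 * a02)
          + a02 * (a01 * a12 - a11 * a02)
    field
      nondegenerate : ¬ (det ≈ 0#)
    form : Carrier → Carrier → Carrier → Carrier
    form x0 x1 x2 = a00 * (x0 * x0) + a11 * (x1 * x1) + a22 * (x2 * x2)
                    + (1# + 1#) * (a01 * (x0 * x1))
                    + (1# + 1#) * (a02 * (x0 * x2))
                    + (1# + 1#) * (a12 * (x1 * x2))

  NonZero3 : Carrier → Carrier → Carrier → Set ℓ
  NonZero3 x0 x1 x2 = ¬ ((x0 ≈ 0#) × (x1 ≈ 0#) × (x2 ≈ 0#))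

  -- the point (x0 : x1 : x2 : 0) of π∞ lies on the conic C
  OnConic : Conic → Carrier → Carrier → Carrier → Set ℓ
  OnConic C x0 x1 x2 = NonZero3 x0 x1 x2 × (Conic.form C x0 x1 x2 ≈ 0#)

  LineMeetsConic : Conic → Carrier → Carrier → Carrier → Set (c ⊔ ℓ)
  LineMeetsConic C y z w =
    ∃ λ x0 → ∃ λ x1 → ∃ λ x2 →
      OnConic C x0 x1 x2 × (y * x0 + z * x1 + w * x2 ≈ 0#)

-- Write Pᵢ = (aᵢ, bᵢ, cᵢ) and n = (y, z, w), so that the i-th factor is X + Pᵢ · n,
-- and let x be a point of C on the line n · x = 0. For any e with e · n ≠ 0 the
-- linear map v ↦ (v · n, v · (x ⨯ e)) has kernel spanned by x, so two distinct
-- points Pᵢ, Pⱼ with the same image would span the direction x, which lies on C.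
-- Hence i ↦ (Pᵢ · (x ⨯ e), Pᵢ · n) is injective into F_q², and the product of the
-- X + Pᵢ · n divides the product of X + r over all (φ, r) ∈ F_q². That product is
-- (∏_{r ∈ F_q} (X + r))^q, which divides (X^q − X)^q because every element of F_q
-- is a root of X^q − X.

module Submission where

open import Defs
open import Algebra.Bundles using (CommutativeMonoid; CommutativeRing; RawRing)
import Algebra.Solver.Ring.AlmostCommutativeRing as ACR
open import Data.Fin using (Fin; zero; suc; punchOut; _↑ˡ_; _↑ʳ_; combine; remQuot)
open import Data.Fin.Properties
  using (punchIn-punchOut; punchOut-injective; punchInᵢ≢i; suc-injective; remQuot-combine; combine-injective)
  renaming (_≟_ to _≟ᶠ_)
open import Data.Integer as ℤ using (ℤ; +_; -[1+_]; _◃_)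
import Data.Integer.Properties as ℤ
open import Data.List using ([]; _∷_)
open import Data.Maybe using (Maybe; just; nothing)
open import Data.Nat as ℕ using (ℕ; zero; suc)
import Data.Nat.Properties as ℕ
open import Data.Product as Product using (_×_; _,_; proj₁; proj₂; ∃)
open import Data.Sign as Sign using ()
open import Data.Vec.Functional using (removeAt)
open import Data.Vec.N-ary using (N-ary)
open import Function using (_∘_)
open import Function.Definitions using (Injective)
open import Level using (0ℓ)
open import Relation.Binary.Bundles using (Setoid)
open import Relation.Binary.Definitions using (Decidable)
open import Relation.Binary.PropositionalEquality as ≡ using (_≡_; _≢_)
import Relation.Binary.Reasoning.Setoid
open import Relation.Binary.Structures using (IsEquivalence)
open import Relation.Nullary using (¬_; yes; no)
open import Relation.Nullary.Negation using (contradiction)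

module FiniteProducts {c ℓ} (M : CommutativeMonoid c ℓ) where
  open CommutativeMonoid M
  open import Algebra.Properties.CommutativeMonoid.Sum M public
    using ()
    renaming ( sum to ∏; sum-cong-≋ to ∏-cong; sum-remove to ∏-remove
             ; sum-replicate to ∏-replicate; ∑-distrib-+ to ∏-distrib-∙)
  open import Algebra.Properties.CommutativeMonoid.Sum M using (sum-replicate-zero)
  open import Algebra.Properties.Monoid.Divisibility monoid public
    using (_∣ʳ_; _,_; ε∣ʳ_; ∣ʳ-respˡ-≈; ∣ʳ-respʳ-≈; ∣ʳ-preorder)
  open import Algebra.Properties.CommutativeSemigroup.Divisibility commutativeSemigroup public
    using (∙-cong-∣; x∣y⇒zx∣zy)
  open import Relation.Binary.Reasoning.Setoid setoid

  ∏-singleton : ∀ {n} (g : Fin n → Carrier) (i : Fin n) → (∀ j → j ≢ i → g j ≈ ε) → ∏ g ≈ g i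
  ∏-singleton {suc n} g i others = begin
    ∏ g                     ≈⟨ ∏-remove g ⟩
    g i ∙ ∏ (removeAt g i)  ≈⟨ ∙-congˡ (∏-cong {n} λ j → others _ (punchInᵢ≢i i j)) ⟩
    g i ∙ ∏ {n} (λ _ → ε)   ≈⟨ ∙-congˡ (sum-replicate-zero n) ⟩
    g i ∙ ε                 ≈⟨ identityʳ (g i) ⟩
    g i                     ∎

  ∏-++ : ∀ m {n} (f : Fin (m ℕ.+ n) → Carrier) → ∏ f ≈ ∏ (f ∘ (_↑ˡ n)) ∙ ∏ (f ∘ (m ↑ʳ_))
  ∏-++ zero    f = sym (identityˡ _)
  ∏-++ (suc m) f = trans (∙-congˡ (∏-++ m (f ∘ suc))) (sym (assoc _ _ _))

  ∏-combine : ∀ m {n} (f : Fin (m ℕ.* n) → Carrier) → ∏ f ≈ ∏ {m} (λ i → ∏ {n} (λ j → f (combine i j)))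
  ∏-combine zero        f = refl
  ∏-combine (suc m) {n} f = trans (∏-++ n f) (∙-congˡ (∏-combine m (f ∘ (n ↑ʳ_))))

  ∏-cong-∣ : ∀ {n} {f g : Fin n → Carrier} → (∀ i → f i ∣ʳ g i) → ∏ f ∣ʳ ∏ g
  ∏-cong-∣ {zero}  f∣g = ε∣ʳ ε
  ∏-cong-∣ {suc n} f∣g = ∙-cong-∣ (f∣g zero) (∏-cong-∣ (f∣g ∘ suc))

  module _ {n m} {ι : Fin (suc n) → Fin (suc m)} (ι-injective : Injective _≡_ _≡_ ι) where
    private
      ι0≢ι∘suc : ∀ i → ι zero ≢ ι (suc i)
      ι0≢ι∘suc i eq with () ← ι-injective eq

    shrink : Fin n → Fin m
    shrink i = punchOut (ι0≢ι∘suc i)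

    shrink-injective : Injective _≡_ _≡_ shrink
    shrink-injective eq = suc-injective (ι-injective (punchOut-injective (ι0≢ι∘suc _) (ι0≢ι∘suc _) eq))

    ∏-∘-injection : ∀ g → ∏ (g ∘ ι) ≈ g (ι zero) ∙ ∏ (removeAt g (ι zero) ∘ shrink)
    ∏-∘-injection g = ∙-congˡ (∏-cong λ i → reflexive (≡.cong g (≡.sym (punchIn-punchOut (ι0≢ι∘suc i)))))

  ∏-permute-injective : ∀ {n} (g : Fin n → Carrier) {ι : Fin n → Fin n} →
                        Injective _≡_ _≡_ ι → ∏ (g ∘ ι) ≈ ∏ g
  ∏-permute-injective {zero}  g inj = refl
  ∏-permute-injective {suc n} g {ι} inj = begin
    ∏ (g ∘ ι)                                          ≈⟨ ∏-∘-injection inj g ⟩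
    g (ι zero) ∙ ∏ (removeAt g (ι zero) ∘ shrink inj)  ≈⟨ ∙-congˡ (∏-permute-injective _ (shrink-injective inj)) ⟩
    g (ι zero) ∙ ∏ (removeAt g (ι zero))               ≈⟨ ∏-remove g ⟨
    ∏ g                                                ∎

  ∏-∘-injective-∣ : ∀ {n m} (g : Fin m → Carrier) {ι : Fin n → Fin m} →
                    Injective _≡_ _≡_ ι → ∏ (g ∘ ι) ∣ʳ ∏ g
  ∏-∘-injective-∣ {zero}          g inj = ε∣ʳ ∏ g
  ∏-∘-injective-∣ {suc n} {zero}  g {ι} inj with () ← ι zero
  ∏-∘-injective-∣ {suc n} {suc m} g {ι} inj =
    ∣ʳ-respˡ-≈ (sym (∏-∘-injection inj g)) (∣ʳ-respʳ-≈ (sym (∏-remove g))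
      (x∣y⇒zx∣zy (g (ι zero)) (∏-∘-injective-∣ (removeAt g (ι zero)) (shrink-injective inj))))

-- Over a raw ring, so that the same definitions apply to ring elements and to
-- solver expressions.
module Coordinates {c ℓ} (R : RawRing c ℓ) where
  open RawRing R

  private
    infixl 6 _-_
    _-_ : Carrier → Carrier → Carrier
    x - y = x + - y

  infixl 7 _·_ _⊙_
  infixl 6 _⊕_ _⊖_
  infix  8 _⨯_
  infix  4 _≈³_

  Triple : Set c
  Triple = Carrier × Carrier × Carrier

  _≈³_ : Triple → Triple → Set ℓ
  (x₀ , x₁ , x₂) ≈³ (y₀ , y₁ , y₂) = x₀ ≈ y₀ × x₁ ≈ y₁ × x₂ ≈ y₂

  _·_ : Triple → Triple → Carrier
  (x₀ , x₁ , x₂) · (y₀ , y₁ , y₂) = x₀ * y₀ + x₁ * y₁ + x₂ * y₂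

  _⨯_ : Triple → Triple → Triple
  (x₀ , x₁ , x₂) ⨯ (y₀ , y₁ , y₂) = x₁ * y₂ - x₂ * y₁ , x₂ * y₀ - x₀ * y₂ , x₀ * y₁ - x₁ * y₀

  _⊙_ : Carrier → Triple → Triple
  t ⊙ (x₀ , x₁ , x₂) = t * x₀ , t * x₁ , t * x₂

  _⊕_ _⊖_ : Triple → Triple → Triple
  (x₀ , x₁ , x₂) ⊕ (y₀ , y₁ , y₂) = x₀ + y₀ , x₁ + y₁ , x₂ + y₂
  (x₀ , x₁ , x₂) ⊖ (y₀ , y₁ , y₂) = x₀ - y₀ , x₁ - y₁ , x₂ - y₂

  -- At the coefficients of a conic this is Conic.form, definitionally.
  quadraticForm : (a₀₀ a₁₁ a₂₂ a₀₁ a₀₂ a₁₂ : Carrier) → Triple → Carrier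
  quadraticForm a₀₀ a₁₁ a₂₂ a₀₁ a₀₂ a₁₂ (x₀ , x₁ , x₂) =
    a₀₀ * (x₀ * x₀) + a₁₁ * (x₁ * x₁) + a₂₂ * (x₂ * x₂)
    + (1# + 1#) * (a₀₁ * (x₀ * x₁)) + (1# + 1#) * (a₀₂ * (x₀ * x₂)) + (1# + 1#) * (a₁₂ * (x₁ * x₂))

-- The solvers of the library draw coefficients from the ring itself, where they
-- cannot see that a coefficient such as 1# + - 1# vanishes; with integer
-- coefficients the normaliser cancels terms.
module IntegerCoefficientSolver {c ℓ} (R : CommutativeRing c ℓ) where
  open CommutativeRing R
  open import Algebra.Properties.Ring ring
    using (-0#≈0#; -‿involutive; -‿distribˡ-*; -‿distribʳ-*; -‿anti-homo-+)
  open import Algebra.Properties.Semiring.Mult.TCOptimised semiring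
    using (1+×; ×-homo-+; ×1-homo-*) renaming (_×_ to _×′_)
  open import Relation.Binary.Reasoning.Setoid setoid

  -- With _×′_, ⟦ + 0 ⟧ and ⟦ + 1 ⟧ are 0# and 1# definitionally.
  ⟦_⟧ : ℤ → Carrier
  ⟦ + n ⟧      = n ×′ 1#
  ⟦ -[1+ n ] ⟧ = - (suc n ×′ 1#)

  private
    ⟦+◃_⟧ : ∀ n → ⟦ Sign.+ ◃ n ⟧ ≈ n ×′ 1#
    ⟦+◃ n ⟧ = reflexive (≡.cong ⟦_⟧ (ℤ.+◃n≡+n n))

    ⟦-◃_⟧ : ∀ n → ⟦ Sign.- ◃ n ⟧ ≈ - (n ×′ 1#)
    ⟦-◃ zero  ⟧ = sym -0#≈0#
    ⟦-◃ suc n ⟧ = refl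

    1+x-[1+y]≈x-y : ∀ x y → (1# + x) - (1# + y) ≈ x - y
    1+x-[1+y]≈x-y x y = begin
      (1# + x) + - (1# + y)    ≈⟨ +-cong (+-comm 1# x) (-‿anti-homo-+ 1# y) ⟩
      (x + 1#) + (- y + - 1#)  ≈⟨ +-congˡ (+-comm (- y) (- 1#)) ⟩
      (x + 1#) + (- 1# + - y)  ≈⟨ +-assoc x 1# _ ⟩
      x + (1# + (- 1# + - y))  ≈⟨ +-congˡ (+-assoc 1# (- 1#) (- y)) ⟨
      x + ((1# + - 1#) + - y)  ≈⟨ +-congˡ (+-congʳ (-‿inverseʳ 1#)) ⟩
      x + (0# + - y)           ≈⟨ +-congˡ (+-identityˡ (- y)) ⟩
      x - y                    ∎

    ⊖-homo : ∀ m n → ⟦ m ℤ.⊖ n ⟧ ≈ m ×′ 1# - n ×′ 1#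
    ⊖-homo m       zero    = sym (trans (+-congˡ -0#≈0#) (+-identityʳ _))
    ⊖-homo zero    (suc n) = sym (+-identityˡ _)
    ⊖-homo (suc m) (suc n) = begin
      ⟦ suc m ℤ.⊖ suc n ⟧              ≡⟨ ≡.cong ⟦_⟧ (ℤ.[1+m]⊖[1+n]≡m⊖n m n) ⟩
      ⟦ m ℤ.⊖ n ⟧                      ≈⟨ ⊖-homo m n ⟩
      m ×′ 1# - n ×′ 1#                ≈⟨ 1+x-[1+y]≈x-y (m ×′ 1#) (n ×′ 1#) ⟨
      (1# + m ×′ 1#) - (1# + n ×′ 1#)  ≈⟨ +-cong (sym (1+× m 1#)) (-‿cong (sym (1+× n 1#))) ⟩
      suc m ×′ 1# - suc n ×′ 1#        ∎

  +-homo : ∀ i j → ⟦ i ℤ.+ j ⟧ ≈ ⟦ i ⟧ + ⟦ j ⟧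
  +-homo (+ m)    (+ n)    = ×-homo-+ 1# m n
  +-homo (+ m)    -[1+ n ] = ⊖-homo m (suc n)
  +-homo -[1+ m ] (+ n)    = trans (⊖-homo n (suc m)) (+-comm _ _)
  +-homo -[1+ m ] -[1+ n ] = begin
    - (suc (suc (m ℕ.+ n)) ×′ 1#)       ≡⟨ ≡.cong (λ k → - (k ×′ 1#)) (ℕ.+-suc (suc m) n) ⟨
    - ((suc m ℕ.+ suc n) ×′ 1#)         ≈⟨ -‿cong (×-homo-+ 1# (suc m) (suc n)) ⟩
    - (suc m ×′ 1# + suc n ×′ 1#)       ≈⟨ -‿anti-homo-+ _ _ ⟩
    - (suc n ×′ 1#) + - (suc m ×′ 1#)   ≈⟨ +-comm _ _ ⟩
    - (suc m ×′ 1#) + - (suc n ×′ 1#)   ∎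

  *-homo : ∀ i j → ⟦ i ℤ.* j ⟧ ≈ ⟦ i ⟧ * ⟦ j ⟧
  *-homo (+ m)    (+ n)    = trans ⟦+◃ m ℕ.* n ⟧ (×1-homo-* m n)
  *-homo (+ m)    -[1+ n ] = trans ⟦-◃ m ℕ.* suc n ⟧ (trans (-‿cong (×1-homo-* m (suc n))) (-‿distribʳ-* _ _))
  *-homo -[1+ m ] (+ n)    = trans ⟦-◃ suc m ℕ.* n ⟧ (trans (-‿cong (×1-homo-* (suc m) n)) (-‿distribˡ-* _ _))
  *-homo -[1+ m ] -[1+ n ] = begin
    ⟦ Sign.+ ◃ (suc m ℕ.* suc n) ⟧  ≈⟨ ⟦+◃ suc m ℕ.* suc n ⟧ ⟩
    (suc m ℕ.* suc n) ×′ 1#         ≈⟨ ×1-homo-* (suc m) (suc n) ⟩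
    x * y                           ≈⟨ -‿involutive (x * y) ⟨
    - - (x * y)                     ≈⟨ -‿cong (-‿distribˡ-* x y) ⟩
    - (- x * y)                     ≈⟨ -‿distribʳ-* (- x) y ⟩
    - x * - y                       ∎
    where
    x y : Carrier
    x = suc m ×′ 1#
    y = suc n ×′ 1#

  -‿homo : ∀ i → ⟦ ℤ.- i ⟧ ≈ - ⟦ i ⟧
  -‿homo (+ zero)  = sym -0#≈0#
  -‿homo (+ suc n) = refl
  -‿homo -[1+ n ]  = sym (-‿involutive _)

  almostCommutativeRing : ACR.AlmostCommutativeRing c ℓ
  almostCommutativeRing = ACR.fromCommutativeRing R

  homomorphism : ℤ.+-*-rawRing ACR.-Raw-AlmostCommutative⟶ almostCommutativeRing
  homomorphism = record
    { ⟦_⟧    = ⟦_⟧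
    ; +-homo = +-homo
    ; *-homo = *-homo
    ; -‿homo = -‿homo
    ; 0-homo = refl
    ; 1-homo = refl
    }

  ⟦_⟧-≟ : ∀ i j → Maybe (⟦ i ⟧ ≈ ⟦ j ⟧)
  ⟦ i ⟧-≟ j with i ℤ.≟ j
  ... | yes i≡j = just (reflexive (≡.cong ⟦_⟧ i≡j))
  ... | no  _   = nothing

  open import Algebra.Solver.Ring ℤ.+-*-rawRing almostCommutativeRing homomorphism ⟦_⟧-≟ public
    using (solve; _:=_; Polynomial; _:+_; _:*_; :-_; con)

  expressions : ℕ → RawRing 0ℓ 0ℓ
  expressions m = record
    { Carrier = Polynomial m
    ; _≈_     = _≡_
    ; _+_     = _:+_
    ; _*_     = _:*_
    ; -_      = :-_
    ; 0#      = con (+ 0)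
    ; 1#      = con (+ 1)
    }

module Polynomials {c ℓ} (R : CommutativeRing c ℓ) where
  open Over R hiding (zero)
  open import Algebra.Properties.Ring ring using (-0#≈0#)
  open import Algebra.Properties.CommutativeSemigroup +-commutativeSemigroup using (interchange; x∙yz≈y∙xz)
  open import Algebra.Properties.Semiring.Exp semiring using (_^_)
  open import Relation.Binary.Reasoning.Setoid setoid
  open IntegerCoefficientSolver R using (solve; _:=_; _:+_; _:*_; :-_)

  -- _≈P_ wrapped in a record, so that both polynomials can be inferred from
  -- the type of a proof.
  infix 4 _≋_
  record _≋_ (f g : Pol) : Set ℓ where
    constructor coeffwise
    field coeff-≈ : f ≈P g
  open _≋_ public

  ≋-isEquivalence : IsEquivalence _≋_
  ≋-isEquivalence = record
    { refl  = coeffwise λ _ → refl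
    ; sym   = λ f≋g → coeffwise λ n → sym (coeff-≈ f≋g n)
    ; trans = λ f≋g g≋h → coeffwise λ n → trans (coeff-≈ f≋g n) (coeff-≈ g≋h n)
    }
  open IsEquivalence ≋-isEquivalence public
    using () renaming (refl to ≋-refl; sym to ≋-sym; trans to ≋-trans; reflexive to ≋-reflexive)

  ≋-setoid : Setoid c ℓ
  ≋-setoid = record { isEquivalence = ≋-isEquivalence }

  module ≋-Reasoning = Relation.Binary.Reasoning.Setoid ≋-setoid

  ∷-cong : ∀ {a b f g} → a ≈ b → f ≋ g → a ∷ f ≋ b ∷ g
  ∷-cong a≈b f≋g = coeffwise λ { zero → a≈b ; (suc n) → coeff-≈ f≋g n }

  ∷-cancel : ∀ {a b f g} → a ∷ f ≋ b ∷ g → f ≋ g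
  ∷-cancel a∷f≋b∷g = coeffwise λ n → coeff-≈ a∷f≋b∷g (suc n)

  ∷≋[]⁺ : ∀ {a f} → a ≈ 0# → f ≋ [] → a ∷ f ≋ []
  ∷≋[]⁺ a≈0 f≋0 = coeffwise λ { zero → a≈0 ; (suc n) → coeff-≈ f≋0 n }

  ∷≋[]⁻ : ∀ {a f} → a ∷ f ≋ [] → f ≋ []
  ∷≋[]⁻ a∷f≋0 = coeffwise λ n → coeff-≈ a∷f≋0 (suc n)

  coeff-+P : ∀ f g n → coeff (f +P g) n ≈ coeff f n + coeff g n
  coeff-+P []      g       n       = sym (+-identityˡ _)
  coeff-+P (a ∷ f) []      n       = sym (+-identityʳ _)
  coeff-+P (a ∷ f) (b ∷ g) zero    = refl
  coeff-+P (a ∷ f) (b ∷ g) (suc n) = coeff-+P f g n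

  coeff-scaleP : ∀ a f n → coeff (scaleP a f) n ≈ a * coeff f n
  coeff-scaleP a []      n       = sym (zeroʳ a)
  coeff-scaleP a (b ∷ f) zero    = refl
  coeff-scaleP a (b ∷ f) (suc n) = coeff-scaleP a f n

  coeff-∷*P : ∀ a f g n → coeff ((a ∷ f) *P g) n ≈ a * coeff g n + coeff (0# ∷ f *P g) n
  coeff-∷*P a f g n = trans (coeff-+P (scaleP a g) _ n) (+-congʳ (coeff-scaleP a g n))

  +P-cong : ∀ {f f′ g g′} → f ≋ f′ → g ≋ g′ → f +P g ≋ f′ +P g′
  +P-cong {f} {f′} {g} {g′} f≋f′ g≋g′ = coeffwise λ n → begin
    coeff (f +P g) n         ≈⟨ coeff-+P f g n ⟩
    coeff f n + coeff g n    ≈⟨ +-cong (coeff-≈ f≋f′ n) (coeff-≈ g≋g′ n) ⟩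
    coeff f′ n + coeff g′ n  ≈⟨ coeff-+P f′ g′ n ⟨
    coeff (f′ +P g′) n       ∎

  +P-identityʳ : ∀ f → f +P [] ≋ f
  +P-identityʳ f = coeffwise λ n → trans (coeff-+P f [] n) (+-identityʳ _)

  +P-interchange : ∀ f g h k → (f +P g) +P (h +P k) ≋ (f +P h) +P (g +P k)
  +P-interchange f g h k = coeffwise λ n → begin
    coeff ((f +P g) +P (h +P k)) n
      ≈⟨ trans (coeff-+P (f +P g) (h +P k) n) (+-cong (coeff-+P f g n) (coeff-+P h k n)) ⟩
    (coeff f n + coeff g n) + (coeff h n + coeff k n)
      ≈⟨ interchange _ _ _ _ ⟩
    (coeff f n + coeff h n) + (coeff g n + coeff k n)
      ≈⟨ trans (coeff-+P (f +P h) (g +P k) n) (+-cong (coeff-+P f h n) (coeff-+P g k n)) ⟨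
    coeff ((f +P h) +P (g +P k)) n
      ∎

  0∷-+P : ∀ f g → 0# ∷ (f +P g) ≋ (0# ∷ f) +P (0# ∷ g)
  0∷-+P f g = ∷-cong (sym (+-identityˡ 0#)) ≋-refl

  scaleP-cong : ∀ {a b f g} → a ≈ b → f ≋ g → scaleP a f ≋ scaleP b g
  scaleP-cong {a} {b} {f} {g} a≈b f≋g = coeffwise λ n → begin
    coeff (scaleP a f) n  ≈⟨ coeff-scaleP a f n ⟩
    a * coeff f n         ≈⟨ *-cong a≈b (coeff-≈ f≋g n) ⟩
    b * coeff g n         ≈⟨ coeff-scaleP b g n ⟨
    coeff (scaleP b g) n  ∎

  scaleP-distrib-+P : ∀ a f g → scaleP a (f +P g) ≋ scaleP a f +P scaleP a g
  scaleP-distrib-+P a f g = coeffwise λ n → begin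
    coeff (scaleP a (f +P g)) n
      ≈⟨ trans (coeff-scaleP a (f +P g) n) (*-congˡ (coeff-+P f g n)) ⟩
    a * (coeff f n + coeff g n)
      ≈⟨ distribˡ a _ _ ⟩
    a * coeff f n + a * coeff g n
      ≈⟨ trans (coeff-+P (scaleP a f) (scaleP a g) n) (+-cong (coeff-scaleP a f n) (coeff-scaleP a g n)) ⟨
    coeff (scaleP a f +P scaleP a g) n
      ∎

  scaleP-distrib-+ : ∀ a b f → scaleP (a + b) f ≋ scaleP a f +P scaleP b f
  scaleP-distrib-+ a b f = coeffwise λ n → begin
    coeff (scaleP (a + b) f) n
      ≈⟨ coeff-scaleP (a + b) f n ⟩
    (a + b) * coeff f n
      ≈⟨ distribʳ _ a b ⟩
    a * coeff f n + b * coeff f n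
      ≈⟨ trans (coeff-+P (scaleP a f) (scaleP b f) n) (+-cong (coeff-scaleP a f n) (coeff-scaleP b f n)) ⟨
    coeff (scaleP a f +P scaleP b f) n
      ∎

  scaleP-assoc : ∀ a b f → scaleP (a * b) f ≋ scaleP a (scaleP b f)
  scaleP-assoc a b f = coeffwise λ n → begin
    coeff (scaleP (a * b) f) n       ≈⟨ coeff-scaleP (a * b) f n ⟩
    (a * b) * coeff f n              ≈⟨ *-assoc a b _ ⟩
    a * (b * coeff f n)              ≈⟨ trans (coeff-scaleP a (scaleP b f) n) (*-congˡ (coeff-scaleP b f n)) ⟨
    coeff (scaleP a (scaleP b f)) n  ∎

  *P-zeroˡ : ∀ f g → f ≋ [] → f *P g ≋ []
  *P-zeroˡ []      g f≋0     = ≋-refl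
  *P-zeroˡ (a ∷ f) g a∷f≋0 = coeffwise λ n → begin
    coeff ((a ∷ f) *P g) n                 ≈⟨ coeff-∷*P a f g n ⟩
    a * coeff g n + coeff (0# ∷ f *P g) n  ≈⟨ +-cong (*-congʳ (coeff-≈ a∷f≋0 0)) (coeff-≈ 0∷f*g≋0 n) ⟩
    0# * coeff g n + 0#                    ≈⟨ trans (+-identityʳ _) (zeroˡ _) ⟩
    0#                                     ∎
    where
    0∷f*g≋0 : 0# ∷ f *P g ≋ []
    0∷f*g≋0 = ∷≋[]⁺ refl (*P-zeroˡ f g (∷≋[]⁻ a∷f≋0))

  *P-zeroʳ : ∀ f → f *P [] ≋ []
  *P-zeroʳ []      = ≋-refl
  *P-zeroʳ (a ∷ f) = ∷≋[]⁺ refl (*P-zeroʳ f)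

  *P-congˡ : ∀ {f f′} g → f ≋ f′ → f *P g ≋ f′ *P g
  *P-congˡ {[]}    {[]}     g f≋f′ = ≋-refl
  *P-congˡ {[]}    {b ∷ f′} g f≋f′ = ≋-sym (*P-zeroˡ (b ∷ f′) g (≋-sym f≋f′))
  *P-congˡ {a ∷ f} {[]}     g f≋f′ = *P-zeroˡ (a ∷ f) g f≋f′
  *P-congˡ {a ∷ f} {b ∷ f′} g f≋f′ =
    +P-cong (scaleP-cong (coeff-≈ f≋f′ 0) ≋-refl) (∷-cong refl (*P-congˡ g (∷-cancel f≋f′)))

  *P-congʳ : ∀ f {g g′} → g ≋ g′ → f *P g ≋ f *P g′
  *P-congʳ []      g≋g′ = ≋-refl
  *P-congʳ (a ∷ f) g≋g′ = +P-cong (scaleP-cong refl g≋g′) (∷-cong refl (*P-congʳ f g≋g′))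

  *P-cong : ∀ {f f′ g g′} → f ≋ f′ → g ≋ g′ → f *P g ≋ f′ *P g′
  *P-cong {f′ = f′} {g} f≋f′ g≋g′ = ≋-trans (*P-congˡ g f≋f′) (*P-congʳ f′ g≋g′)

  *P-distribʳ-+P : ∀ f g h → (f +P g) *P h ≋ f *P h +P g *P h
  *P-distribʳ-+P []      g       h = ≋-refl
  *P-distribʳ-+P (a ∷ f) []      h = ≋-sym (+P-identityʳ ((a ∷ f) *P h))
  *P-distribʳ-+P (a ∷ f) (b ∷ g) h =
    ≋-trans (+P-cong (scaleP-distrib-+ a b h)
                     (≋-trans (∷-cong refl (*P-distribʳ-+P f g h)) (0∷-+P (f *P h) (g *P h))))
            (+P-interchange (scaleP a h) (scaleP b h) (0# ∷ f *P h) (0# ∷ g *P h))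

  scaleP-*P : ∀ a f g → scaleP a f *P g ≋ scaleP a (f *P g)
  scaleP-*P a []      g = ≋-refl
  scaleP-*P a (b ∷ f) g =
    ≋-trans (+P-cong (scaleP-assoc a b g) (∷-cong (sym (zeroʳ a)) (scaleP-*P a f g)))
            (≋-sym (scaleP-distrib-+P a (scaleP b g) (0# ∷ f *P g)))

  0∷-*P : ∀ f g → (0# ∷ f) *P g ≋ 0# ∷ f *P g
  0∷-*P f g = coeffwise λ n → begin
    coeff ((0# ∷ f) *P g) n                 ≈⟨ coeff-∷*P 0# f g n ⟩
    0# * coeff g n + coeff (0# ∷ f *P g) n  ≈⟨ +-congʳ (zeroˡ _) ⟩
    0# + coeff (0# ∷ f *P g) n              ≈⟨ +-identityˡ _ ⟩
    coeff (0# ∷ f *P g) n                   ∎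

  *P-assoc : ∀ f g h → (f *P g) *P h ≋ f *P (g *P h)
  *P-assoc []      g h = ≋-refl
  *P-assoc (a ∷ f) g h =
    ≋-trans (*P-distribʳ-+P (scaleP a g) (0# ∷ f *P g) h)
            (+P-cong (scaleP-*P a g h) (≋-trans (0∷-*P (f *P g) h) (∷-cong refl (*P-assoc f g h))))

  *P-∷ʳ : ∀ f b g → f *P (b ∷ g) ≋ scaleP b f +P (0# ∷ f *P g)
  *P-∷ʳ []      b g = ≋-sym (∷≋[]⁺ refl ≋-refl)
  *P-∷ʳ (a ∷ f) b g = coeffwise λ
    { zero    → trans (+-identityʳ _) (trans (*-comm a b) (sym (+-identityʳ _)))
    ; (suc n) → begin
      coeff (scaleP a g +P f *P (b ∷ g)) n
        ≈⟨ coeff-+P (scaleP a g) _ n ⟩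
      coeff (scaleP a g) n + coeff (f *P (b ∷ g)) n
        ≈⟨ +-congˡ (trans (coeff-≈ (*P-∷ʳ f b g) n) (coeff-+P (scaleP b f) _ n)) ⟩
      coeff (scaleP a g) n + (coeff (scaleP b f) n + coeff (0# ∷ f *P g) n)
        ≈⟨ x∙yz≈y∙xz _ _ _ ⟩
      coeff (scaleP b f) n + (coeff (scaleP a g) n + coeff (0# ∷ f *P g) n)
        ≈⟨ +-congˡ (coeff-+P (scaleP a g) _ n) ⟨
      coeff (scaleP b f) n + coeff ((a ∷ f) *P g) n
        ≈⟨ coeff-+P (scaleP b f) _ n ⟨
      coeff (scaleP b f +P (a ∷ f) *P g) n
        ∎ }

  *P-comm : ∀ f g → f *P g ≋ g *P f
  *P-comm []      g = ≋-sym (*P-zeroʳ g)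
  *P-comm (a ∷ f) g = ≋-trans (+P-cong ≋-refl (∷-cong refl (*P-comm f g))) (≋-sym (*P-∷ʳ g a f))

  *P-identityˡ : ∀ f → oneP *P f ≋ f
  *P-identityˡ f = coeffwise λ n → begin
    coeff (oneP *P f) n                 ≈⟨ coeff-∷*P 1# [] f n ⟩
    1# * coeff f n + coeff (0# ∷ []) n  ≈⟨ +-cong (*-identityˡ _) (coeff-≈ (∷≋[]⁺ refl ≋-refl) n) ⟩
    coeff f n + 0#                      ≈⟨ +-identityʳ _ ⟩
    coeff f n                           ∎

  *P-commutativeMonoid : CommutativeMonoid c ℓ
  *P-commutativeMonoid = record
    { Carrier             = Pol
    ; _≈_                 = _≋_
    ; _∙_                 = _*P_
    ; ε                   = oneP
    ; isCommutativeMonoid = record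
      { isMonoid = record
        { isSemigroup = record
          { isMagma = record { isEquivalence = ≋-isEquivalence ; ∙-cong = *P-cong }
          ; assoc   = *P-assoc
          }
        ; identity = *P-identityˡ , λ f → ≋-trans (*P-comm f oneP) (*P-identityˡ f)
        }
      ; comm = *P-comm
      }
    }

  module ∏P = FiniteProducts *P-commutativeMonoid
  open ∏P using (_,_)
  private module ∏ = FiniteProducts *-commutativeMonoid

  ∏P≋∏ : ∀ n (f : Fin n → Pol) → ∏P n f ≋ ∏P.∏ f
  ∏P≋∏ zero    f = ≋-refl
  ∏P≋∏ (suc n) f = *P-congʳ (f zero) (∏P≋∏ n (f ∘ suc))

  ^P≋∏ : ∀ f n → f ^P n ≋ ∏P.∏ {n} (λ _ → f)
  ^P≋∏ f zero    = ≋-refl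
  ^P≋∏ f (suc n) = *P-congʳ f (^P≋∏ f n)

  ∏-∣ʳ⇒∏P-∣P : ∀ {n} (f : Fin n → Pol) {g} → ∏P.∏ f ∏P.∣ʳ g → ∏P n f ∣P g
  ∏-∣ʳ⇒∏P-∣P {n} f (k , k*∏f≋g) =
    k , coeff-≈ (≋-trans (*P-comm (∏P n f) k) (≋-trans (*P-congʳ k (∏P≋∏ n f)) k*∏f≋g))

  eval : Pol → Carrier → Carrier
  eval []      s = 0#
  eval (a ∷ f) s = a + s * eval f s

  eval-+P : ∀ f g s → eval (f +P g) s ≈ eval f s + eval g s
  eval-+P []      g       s = sym (+-identityˡ _)
  eval-+P (a ∷ f) []      s = sym (+-identityʳ _)
  eval-+P (a ∷ f) (b ∷ g) s = begin
    (a + b) + s * eval (f +P g) s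
      ≈⟨ +-congˡ (*-congˡ (eval-+P f g s)) ⟩
    (a + b) + s * (eval f s + eval g s)
      ≈⟨ solve 5 (λ a b s x y → (a :+ b) :+ s :* (x :+ y) := (a :+ s :* x) :+ (b :+ s :* y)) refl a b s _ _ ⟩
    (a + s * eval f s) + (b + s * eval g s)
      ∎

  eval-scaleP : ∀ a f s → eval (scaleP a f) s ≈ a * eval f s
  eval-scaleP a []      s = sym (zeroʳ a)
  eval-scaleP a (b ∷ f) s = begin
    a * b + s * eval (scaleP a f) s
      ≈⟨ +-congˡ (*-congˡ (eval-scaleP a f s)) ⟩
    a * b + s * (a * eval f s)
      ≈⟨ solve 4 (λ a b s x → a :* b :+ s :* (a :* x) := a :* (b :+ s :* x)) refl a b s _ ⟩
    a * (b + s * eval f s)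
      ∎

  eval-negP : ∀ f s → eval (negP f) s ≈ - eval f s
  eval-negP []      s = sym -0#≈0#
  eval-negP (a ∷ f) s = begin
    - a + s * eval (negP f) s  ≈⟨ +-congˡ (*-congˡ (eval-negP f s)) ⟩
    - a + s * - eval f s       ≈⟨ solve 3 (λ a s x → :- a :+ s :* :- x := :- (a :+ s :* x)) refl a s _ ⟩
    - (a + s * eval f s)       ∎

  eval-*P : ∀ f g s → eval (f *P g) s ≈ eval f s * eval g s
  eval-*P []      g s = sym (zeroˡ _)
  eval-*P (a ∷ f) g s = begin
    eval (scaleP a g +P (0# ∷ f *P g)) s
      ≈⟨ eval-+P (scaleP a g) (0# ∷ f *P g) s ⟩
    eval (scaleP a g) s + (0# + s * eval (f *P g) s)
      ≈⟨ +-cong (eval-scaleP a g s) (trans (+-identityˡ _) (*-congˡ (eval-*P f g s))) ⟩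
    a * eval g s + s * (eval f s * eval g s)
      ≈⟨ solve 4 (λ a s x y → a :* y :+ s :* (x :* y) := (a :+ s :* x) :* y) refl a s _ _ ⟩
    (a + s * eval f s) * eval g s
      ∎

  eval-[] : ∀ {f} s → f ≋ [] → eval f s ≈ 0#
  eval-[] {[]}    s f≋0 = refl
  eval-[] {a ∷ f} s f≋0 = begin
    a + s * eval f s  ≈⟨ +-cong (coeff-≈ f≋0 0) (*-congˡ (eval-[] s (∷≋[]⁻ f≋0))) ⟩
    0# + s * 0#       ≈⟨ trans (+-identityˡ _) (zeroʳ s) ⟩
    0#                ∎

  eval-cong : ∀ {f g} s → f ≋ g → eval f s ≈ eval g s
  eval-cong {[]}    {[]}    s f≋g = refl
  eval-cong {[]}    {b ∷ g} s f≋g = sym (eval-[] s (≋-sym f≋g))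
  eval-cong {a ∷ f} {[]}    s f≋g = eval-[] s f≋g
  eval-cong {a ∷ f} {b ∷ g} s f≋g = +-cong (coeff-≈ f≋g 0) (*-congˡ (eval-cong s (∷-cancel f≋g)))

  eval-oneP : ∀ s → eval oneP s ≈ 1#
  eval-oneP s = trans (+-congˡ (zeroʳ s)) (+-identityʳ 1#)

  eval-XP : ∀ s → eval XP s ≈ s
  eval-XP s = trans (+-identityˡ _) (trans (*-congˡ (eval-oneP s)) (*-identityʳ s))

  eval-^P : ∀ f n s → eval (f ^P n) s ≈ eval f s ^ n
  eval-^P f zero    s = eval-oneP s
  eval-^P f (suc n) s = trans (eval-*P f (f ^P n) s) (*-congˡ (eval-^P f n s))

  eval-∏ : ∀ {n} (f : Fin n → Pol) s → eval (∏P.∏ f) s ≈ ∏.∏ (λ i → eval (f i) s)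
  eval-∏ {zero}  f s = eval-oneP s
  eval-∏ {suc n} f s = trans (eval-*P (f zero) _ s) (*-congˡ (eval-∏ (f ∘ suc) s))

  X+_ : Carrier → Pol
  X+ u = u ∷ 1# ∷ []

  X+-cong : ∀ {u v} → u ≈ v → X+ u ≋ X+ v
  X+-cong u≈v = ∷-cong u≈v ≋-refl

  eval-X+ : ∀ u s → eval (X+ u) s ≈ u + s
  eval-X+ u s = +-congˡ (trans (*-congˡ (eval-oneP s)) (*-identityʳ s))

  quotient : Pol → Carrier → Pol
  quotient []      s = []
  quotient (a ∷ f) s = eval f s ∷ quotient f s

  division-identity : ∀ f s → X+ (- s) *P quotient f s +P (eval f s ∷ []) ≋ f
  division-identity []      s = ∷≋[]⁺ (+-identityˡ 0#) (∷≋[]⁺ refl ≋-refl)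
  division-identity (a ∷ f) s = coeffwise λ
    { zero    → trans (+-congʳ (+-identityʳ _)) (solve 3 (λ s r a → :- s :* r :+ (a :+ s :* r) := a) refl s r a)
    ; (suc n) → begin
      coeff (scaleP (- s) q +P oneP *P (r ∷ q) +P []) n
        ≈⟨ coeff-≈ (+P-identityʳ (scaleP (- s) q +P oneP *P (r ∷ q))) n ⟩
      coeff (scaleP (- s) q +P oneP *P (r ∷ q)) n
        ≈⟨ coeff-+P (scaleP (- s) q) _ n ⟩
      coeff (scaleP (- s) q) n + coeff (oneP *P (r ∷ q)) n
        ≈⟨ +-congˡ (coeff-≈ (*P-identityˡ (r ∷ q)) n) ⟩
      coeff (scaleP (- s) q) n + coeff (r ∷ q) n
        ≈⟨ +-congˡ (coeff-r∷q n) ⟨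
      coeff (scaleP (- s) q) n + (coeff (0# ∷ oneP *P q) n + coeff (r ∷ []) n)
        ≈⟨ +-assoc _ _ _ ⟨
      (coeff (scaleP (- s) q) n + coeff (0# ∷ oneP *P q) n) + coeff (r ∷ []) n
        ≈⟨ +-congʳ (coeff-+P (scaleP (- s) q) _ n) ⟨
      coeff (X+ (- s) *P q) n + coeff (r ∷ []) n
        ≈⟨ coeff-+P (X+ (- s) *P q) _ n ⟨
      coeff (X+ (- s) *P q +P (r ∷ [])) n
        ≈⟨ coeff-≈ (division-identity f s) n ⟩
      coeff f n
        ∎ }
    where
    r : Carrier
    r = eval f s
    q : Pol
    q = quotient f s
    coeff-r∷q : ∀ n → coeff (0# ∷ oneP *P q) n + coeff (r ∷ []) n ≈ coeff (r ∷ q) n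
    coeff-r∷q zero    = +-identityˡ r
    coeff-r∷q (suc n) = trans (+-identityʳ _) (coeff-≈ (*P-identityˡ q) n)

  factor-theorem : ∀ f s → eval f s ≈ 0# → f ≋ X+ (- s) *P quotient f s
  factor-theorem f s f[s]≈0 =
    ≋-trans (≋-sym (division-identity f s))
            (≋-trans (+P-cong ≋-refl (∷≋[]⁺ f[s]≈0 ≋-refl)) (+P-identityʳ _))

module FieldProperties {c ℓ} (F : CommutativeRing c ℓ) (isField : Over.IsField F) where
  open Over F hiding (zero)
  open IsField isField
  open FiniteProducts *-commutativeMonoid using (∏)
  open import Relation.Binary.Reasoning.Setoid setoid

  *-cancelˡ : ∀ {x y z} → x ≉ 0# → x * y ≈ x * z → y ≈ z
  *-cancelˡ {x} {y} {z} x≉0 xy≈xz with x⁻¹ , xx⁻¹≈1 ← inverse x x≉0 = begin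
    y              ≈⟨ *-identityˡ y ⟨
    1# * y         ≈⟨ *-congʳ x⁻¹x≈1 ⟨
    (x⁻¹ * x) * y  ≈⟨ *-assoc _ _ _ ⟩
    x⁻¹ * (x * y)  ≈⟨ *-congˡ xy≈xz ⟩
    x⁻¹ * (x * z)  ≈⟨ *-assoc _ _ _ ⟨
    (x⁻¹ * x) * z  ≈⟨ *-congʳ x⁻¹x≈1 ⟩
    1# * z         ≈⟨ *-identityˡ z ⟩
    z              ∎
    where
    x⁻¹x≈1 : x⁻¹ * x ≈ 1#
    x⁻¹x≈1 = trans (*-comm x⁻¹ x) xx⁻¹≈1

  x≉0∧xy≈0⇒y≈0 : ∀ {x y} → x ≉ 0# → x * y ≈ 0# → y ≈ 0#
  x≉0∧xy≈0⇒y≈0 {x} x≉0 xy≈0 = *-cancelˡ x≉0 (trans xy≈0 (sym (zeroʳ x)))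

  *-nonzero : ∀ {x y} → x ≉ 0# → y ≉ 0# → x * y ≉ 0#
  *-nonzero x≉0 y≉0 xy≈0 = y≉0 (x≉0∧xy≈0⇒y≈0 x≉0 xy≈0)

  ∏-nonzero : ∀ {n} (f : Fin n → Carrier) → (∀ i → f i ≉ 0#) → ∏ f ≉ 0#
  ∏-nonzero {zero}  f f≉0 = 1≉0
  ∏-nonzero {suc n} f f≉0 = *-nonzero (f≉0 zero) (∏-nonzero (f ∘ suc) (f≉0 ∘ suc))

module RootFactors {c ℓ} (F : CommutativeRing c ℓ) (isField : Over.IsField F) where
  open Over F hiding (zero)
  open FieldProperties F isField
  open Polynomials F
  open ∏P using (_∣ʳ_; _,_; ε∣ʳ_)
  open import Algebra.Properties.Group +-group using (x∙y⁻¹≈ε⇒x≈y; ⁻¹-involutive)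

  ∏-X+-∣ : ∀ {n} (u : Fin n → Carrier) → Injective _≡_ _≈_ u →
           ∀ P → (∀ i → eval P (- u i) ≈ 0#) → ∏P.∏ (X+_ ∘ u) ∣ʳ P
  ∏-X+-∣ {zero}  u u-injective P roots = ε∣ʳ P
  ∏-X+-∣ {suc n} u u-injective P roots
    with K , K*D≋P ← ∏-X+-∣ (u ∘ suc) (suc-injective ∘ u-injective) P (roots ∘ suc) = quotient K s , (begin
      quotient K s *P (X+ u zero *P D)  ≈⟨ *P-assoc (quotient K s) (X+ u zero) D ⟨
      (quotient K s *P X+ u zero) *P D  ≈⟨ *P-congˡ D K≋quotient*X+u₀ ⟨
      K *P D                            ≈⟨ K*D≋P ⟩
      P                                 ∎)
    where
    open ≋-Reasoning
    s : Carrier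
    s = - u zero
    D : Pol
    D = ∏P.∏ (X+_ ∘ u ∘ suc)
    D[s]≉0 : eval D s ≉ 0#
    D[s]≉0 D[s]≈0 = ∏-nonzero _ factor≉0 (trans (sym (eval-∏ (X+_ ∘ u ∘ suc) s)) D[s]≈0)
      where
      factor≉0 : ∀ i → eval (X+ u (suc i)) s ≉ 0#
      factor≉0 i ≈0 with () ← u-injective (x∙y⁻¹≈ε⇒x≈y _ _ (trans (sym (eval-X+ (u (suc i)) s)) ≈0))
    K[s]≈0 : eval K s ≈ 0#
    K[s]≈0 = x≉0∧xy≈0⇒y≈0 D[s]≉0
               (trans (*-comm _ _) (trans (sym (eval-*P K D s)) (trans (eval-cong s K*D≋P) (roots zero))))
    K≋quotient*X+u₀ : K ≋ quotient K s *P X+ u zero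
    K≋quotient*X+u₀ =
      ≋-trans (factor-theorem K s K[s]≈0)
              (≋-trans (*P-comm (X+ (- s)) (quotient K s))
                       (*P-congʳ (quotient K s) (X+-cong (⁻¹-involutive (u zero)))))

private
  -- Coordinate π of both sides of collinearity-identity below.
  module CollinearitySides {a b} (S : RawRing a b) where
    open RawRing S
    open Coordinates S

    sides : (Triple → Carrier) → N-ary 15 Carrier (Carrier × Carrier)
    sides π x₀ x₁ x₂ e₀ e₁ e₂ n₀ n₁ n₂ d₀ d₁ d₂ f₀ f₁ f₂ =
        π ((e · n) ⊙ ((f · x) ⊙ d ⊖ (f · d) ⊙ x))
      , π ((d · n) ⊙ ((x ⨯ e) ⨯ f) ⊖ (d · (x ⨯ e)) ⊙ (n ⨯ f) ⊕ (n · x) ⊙ ((e ⨯ d) ⨯ f))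
      where
      x e n d f : Triple
      x = x₀ , x₁ , x₂
      e = e₀ , e₁ , e₂
      n = n₀ , n₁ , n₂
      d = d₀ , d₁ , d₂
      f = f₀ , f₁ , f₂

module CoordinateIdentities {c ℓ} (R : CommutativeRing c ℓ) where
  open CommutativeRing R
  open Coordinates rawRing
  open IntegerCoefficientSolver R using (solve; _:=_; _:*_; _:+_; :-_; con; expressions)

  -- (e · n) (x ⨯ d) = (d · n) (x ⨯ e) − (d · (x ⨯ e)) n + (n · x) (e ⨯ d), crossed
  -- with f, using (x ⨯ d) ⨯ f = (f · x) d − (f · d) x.
  collinearity-identity : ∀ x e n d f →
    (e · n) ⊙ ((f · x) ⊙ d ⊖ (f · d) ⊙ x) ≈³
    (d · n) ⊙ ((x ⨯ e) ⨯ f) ⊖ (d · (x ⨯ e)) ⊙ (n ⨯ f) ⊕ (n · x) ⊙ ((e ⨯ d) ⨯ f)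
  collinearity-identity (x₀ , x₁ , x₂) (e₀ , e₁ , e₂) (n₀ , n₁ , n₂) (d₀ , d₁ , d₂) (f₀ , f₁ , f₂) =
      solve 15 (Sides.sides proj₁) refl x₀ x₁ x₂ e₀ e₁ e₂ n₀ n₁ n₂ d₀ d₁ d₂ f₀ f₁ f₂
    , solve 15 (Sides.sides (proj₁ ∘ proj₂)) refl x₀ x₁ x₂ e₀ e₁ e₂ n₀ n₁ n₂ d₀ d₁ d₂ f₀ f₁ f₂
    , solve 15 (Sides.sides (proj₂ ∘ proj₂)) refl x₀ x₁ x₂ e₀ e₁ e₂ n₀ n₁ n₂ d₀ d₁ d₂ f₀ f₁ f₂
    where module Sides = CollinearitySides (expressions 15)

  ·-distribʳ-⊖ : ∀ p p′ v → (p ⊖ p′) · v ≈ p · v - p′ · v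
  ·-distribʳ-⊖ (p₀ , p₁ , p₂) (p₀′ , p₁′ , p₂′) (v₀ , v₁ , v₂) =
    solve 9 (λ p₀ p₁ p₂ p₀′ p₁′ p₂′ v₀ v₁ v₂ →
      ((p₀ , p₁ , p₂) E.⊖ (p₀′ , p₁′ , p₂′)) E.· (v₀ , v₁ , v₂) :=
      (p₀ , p₁ , p₂) E.· (v₀ , v₁ , v₂) :+ :- ((p₀′ , p₁′ , p₂′) E.· (v₀ , v₁ , v₂)))
      refl p₀ p₁ p₂ p₀′ p₁′ p₂′ v₀ v₁ v₂
    where module E = Coordinates (expressions 9)

  ·-basis : ∀ v₀ v₁ v₂ → (1# , 0# , 0#) · (v₀ , v₁ , v₂) ≈ v₀
                       × (0# , 1# , 0#) · (v₀ , v₁ , v₂) ≈ v₁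
                       × (0# , 0# , 1#) · (v₀ , v₁ , v₂) ≈ v₂
  ·-basis v₀ v₁ v₂ =
      solve 3 (λ a b c → (𝟙 , 𝟘 , 𝟘) E.· (a , b , c) := a) refl v₀ v₁ v₂
    , solve 3 (λ a b c → (𝟘 , 𝟙 , 𝟘) E.· (a , b , c) := b) refl v₀ v₁ v₂
    , solve 3 (λ a b c → (𝟘 , 𝟘 , 𝟙) E.· (a , b , c) := c) refl v₀ v₁ v₂
    where
    module E = Coordinates (expressions 3)
    open RawRing (expressions 3) using () renaming (0# to 𝟘; 1# to 𝟙)

  quadraticForm-scale : ∀ a₀₀ a₁₁ a₂₂ a₀₁ a₀₂ a₁₂ t x →
    quadraticForm a₀₀ a₁₁ a₂₂ a₀₁ a₀₂ a₁₂ (t ⊙ x) ≈ (t * t) * quadraticForm a₀₀ a₁₁ a₂₂ a₀₁ a₀₂ a₁₂ x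
  quadraticForm-scale a₀₀ a₁₁ a₂₂ a₀₁ a₀₂ a₁₂ t (x₀ , x₁ , x₂) =
    solve 10 (λ a₀₀ a₁₁ a₂₂ a₀₁ a₀₂ a₁₂ t x₀ x₁ x₂ →
      E.quadraticForm a₀₀ a₁₁ a₂₂ a₀₁ a₀₂ a₁₂ (t E.⊙ (x₀ , x₁ , x₂)) :=
      (t :* t) :* E.quadraticForm a₀₀ a₁₁ a₂₂ a₀₁ a₀₂ a₁₂ (x₀ , x₁ , x₂))
      refl a₀₀ a₁₁ a₂₂ a₀₁ a₀₂ a₁₂ t x₀ x₁ x₂
    where module E = Coordinates (expressions 10)

  quadraticForm-cong : ∀ a₀₀ a₁₁ a₂₂ a₀₁ a₀₂ a₁₂ {v w} → v ≈³ w →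
    quadraticForm a₀₀ a₁₁ a₂₂ a₀₁ a₀₂ a₁₂ v ≈ quadraticForm a₀₀ a₁₁ a₂₂ a₀₁ a₀₂ a₁₂ w
  quadraticForm-cong _ _ _ _ _ _ (v₀≈w₀ , v₁≈w₁ , v₂≈w₂) =
    +-cong (+-cong (+-cong (+-cong (+-cong (term v₀≈w₀ v₀≈w₀) (term v₁≈w₁ v₁≈w₁)) (term v₂≈w₂ v₂≈w₂))
      (*-congˡ (term v₀≈w₀ v₁≈w₁))) (*-congˡ (term v₀≈w₀ v₂≈w₂))) (*-congˡ (term v₁≈w₁ v₂≈w₂))
    where
    term : ∀ {a x x′ y y′} → x ≈ x′ → y ≈ y′ → a * (x * y) ≈ a * (x′ * y′)
    term x≈x′ y≈y′ = *-congˡ (*-cong x≈x′ y≈y′)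

  vanishing-combination : ∀ {α β γ} p q r → α ≈ 0# → β ≈ 0# → γ ≈ 0# → α * p - β * q + γ * r ≈ 0#
  vanishing-combination p q r α≈0 β≈0 γ≈0 =
    trans (+-cong (+-cong (*-congʳ α≈0) (-‿cong (*-congʳ β≈0))) (*-congʳ γ≈0))
          (solve 3 (λ p q r → con (+ 0) :* p :+ :- (con (+ 0) :* q) :+ con (+ 0) :* r := con (+ 0)) refl p q r)

module ConicGeometry {c ℓ} (F : CommutativeRing c ℓ) (isField : Over.IsField F) where
  open Over F hiding (zero)
  open Coordinates rawRing
  open CoordinateIdentities F
  open FieldProperties F isField
  open import Algebra.Properties.Group +-group using (x∙y⁻¹≈ε⇒x≈y; x≈y⇒x∙y⁻¹≈ε)

  collinear-of-kernel : ∀ {x e n d} f → n · x ≈ 0# → ¬ e · n ≈ 0# → d · n ≈ 0# → d · (x ⨯ e) ≈ 0# →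
                        (f · x) ⊙ d ≈³ (f · d) ⊙ x
  collinear-of-kernel {x} {e} {n} {d} f n·x≈0 e·n≉0 d·n≈0 d·u≈0 =
    Product.map coordinate (Product.map coordinate coordinate) (collinearity-identity x e n d f)
    where
    coordinate : ∀ {a b p q r} → (e · n) * (a - b) ≈ (d · n) * p - (d · (x ⨯ e)) * q + (n · x) * r → a ≈ b
    coordinate {a} {b} {p} {q} {r} eq =
      x∙y⁻¹≈ε⇒x≈y a b (x≉0∧xy≈0⇒y≈0 e·n≉0 (trans eq (vanishing-combination p q r d·n≈0 d·u≈0 n·x≈0)))

  module _ (C : Conic) where
    open Conic C

    Q : Triple → Carrier
    Q = quadraticForm a00 a11 a22 a01 a02 a12

    NonZero : Triple → Set ℓ
    NonZero (v₀ , v₁ , v₂) = NonZero3 v₀ v₁ v₂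

    IsOnConic : Triple → Set ℓ
    IsOnConic v = NonZero v × Q v ≈ 0#

    Q-of-collinear : ∀ {x d} f → ¬ f · x ≈ 0# → (f · x) ⊙ d ≈³ (f · d) ⊙ x → Q x ≈ 0# → Q d ≈ 0#
    Q-of-collinear {x} {d} f f·x≉0 fx⊙d≈fd⊙x Qx≈0 = x≉0∧xy≈0⇒y≈0 (*-nonzero f·x≉0 f·x≉0) (begin
      ((f · x) * (f · x)) * Q d  ≈⟨ quadraticForm-scale a00 a11 a22 a01 a02 a12 (f · x) d ⟨
      Q ((f · x) ⊙ d)            ≈⟨ quadraticForm-cong a00 a11 a22 a01 a02 a12 fx⊙d≈fd⊙x ⟩
      Q ((f · d) ⊙ x)            ≈⟨ quadraticForm-scale a00 a11 a22 a01 a02 a12 (f · d) x ⟩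
      ((f · d) * (f · d)) * Q x  ≈⟨ *-congˡ Qx≈0 ⟩
      ((f · d) * (f · d)) * 0#   ≈⟨ zeroʳ _ ⟩
      0#                         ∎)
      where open import Relation.Binary.Reasoning.Setoid setoid

    Q-difference≈0 : ∀ {x e n p p′} f → Q x ≈ 0# → n · x ≈ 0# → ¬ e · n ≈ 0# → ¬ f · x ≈ 0# →
                     p · n ≈ p′ · n → p · (x ⨯ e) ≈ p′ · (x ⨯ e) → Q (p ⊖ p′) ≈ 0#
    Q-difference≈0 {x} {e} {n} {p} {p′} f Qx≈0 n·x≈0 e·n≉0 f·x≉0 p·n≈p′·n p·u≈p′·u =
      Q-of-collinear f f·x≉0 (collinear-of-kernel f n·x≈0 e·n≉0 (·-≈0 n p·n≈p′·n) (·-≈0 (x ⨯ e) p·u≈p′·u)) Qx≈0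
      where
      ·-≈0 : ∀ v → p · v ≈ p′ · v → (p ⊖ p′) · v ≈ 0#
      ·-≈0 v p·v≈p′·v = trans (·-distribʳ-⊖ p p′ v) (x≈y⇒x∙y⁻¹≈ε p·v≈p′·v)

    labels-injective : ∀ {m} (P : Fin m → Triple) → (∀ i j → i ≢ j → ¬ P i ≈³ P j) →
                       (∀ i j → i ≢ j → ¬ IsOnConic (P i ⊖ P j)) →
                       ∀ {x e n} f → Q x ≈ 0# → n · x ≈ 0# → ¬ e · n ≈ 0# → ¬ f · x ≈ 0# →
                       ∀ {i j} → P i · (x ⨯ e) ≈ P j · (x ⨯ e) → P i · n ≈ P j · n → i ≡ j
    labels-injective P distinct secant-free f Qx≈0 n·x≈0 e·n≉0 f·x≉0 {i} {j} φ≈ r≈ with i ≟ᶠ j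
    ... | yes i≡j = i≡j
    ... | no  i≢j =
      contradiction (Pi-Pj≢0 , Q-difference≈0 f Qx≈0 n·x≈0 e·n≉0 f·x≉0 r≈ φ≈) (secant-free i j i≢j)
      where
      Pi-Pj≢0 : NonZero (P i ⊖ P j)
      Pi-Pj≢0 (d₀≈0 , d₁≈0 , d₂≈0) =
        distinct i j i≢j (x∙y⁻¹≈ε⇒x≈y _ _ d₀≈0 , x∙y⁻¹≈ε⇒x≈y _ _ d₁≈0 , x∙y⁻¹≈ε⇒x≈y _ _ d₂≈0)

module FiniteField {c ℓ} (F : CommutativeRing c ℓ) (isField : Over.IsField F)
                   {q : ℕ} (hasSize : Over.HasSize F q) where
  open Over F hiding (zero)
  open IsField isField
  open HasSize hasSize
  open FieldProperties F isField
  open FiniteProducts *-commutativeMonoid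
  open Coordinates rawRing using (_·_)
  open CoordinateIdentities F using (·-basis)
  open import Algebra.Properties.Semiring.Exp semiring using (_^_)
  open import Relation.Binary.Reasoning.Setoid setoid

  index : Carrier → Fin q
  index x = proj₁ (enum-surjective x)

  enum-index : ∀ x → enum (index x) ≈ x
  enum-index x = proj₂ (enum-surjective x)

  index-injective : ∀ {x y} → index x ≡ index y → x ≈ y
  index-injective {x} {y} ix≡iy = begin
    x               ≈⟨ enum-index x ⟨
    enum (index x)  ≡⟨ ≡.cong enum ix≡iy ⟩
    enum (index y)  ≈⟨ enum-index y ⟩
    y               ∎

  infix 4 _≟_
  _≟_ : Decidable _≈_
  x ≟ y with index x ≟ᶠ index y
  ... | yes ix≡iy = yes (index-injective ix≡iy)
  ... | no  ix≢iy = no λ x≈y → ix≢iy (enum-injective _ _ (trans (enum-index x) (trans x≈y (sym (enum-index y)))))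

  ∃-·-nonzero : ∀ {v₀ v₁ v₂} → NonZero3 v₀ v₁ v₂ → ∃ λ e → ¬ e · (v₀ , v₁ , v₂) ≈ 0#
  ∃-·-nonzero {v₀} {v₁} {v₂} v≢0 with v₀ ≟ 0# | v₁ ≟ 0# | v₂ ≟ 0#
  ... | no v₀≉0  | _        | _        = (1# , 0# , 0#) , v₀≉0 ∘ trans (sym (proj₁ (·-basis v₀ v₁ v₂)))
  ... | yes _    | no v₁≉0  | _        = (0# , 1# , 0#) , v₁≉0 ∘ trans (sym (proj₁ (proj₂ (·-basis v₀ v₁ v₂))))
  ... | yes _    | yes _    | no v₂≉0  = (0# , 0# , 1#) , v₂≉0 ∘ trans (sym (proj₂ (proj₂ (·-basis v₀ v₁ v₂))))
  ... | yes v₀≈0 | yes v₁≈0 | yes v₂≈0 = contradiction (v₀≈0 , v₁≈0 , v₂≈0) v≢0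

  -- With ν and ζ, Lagrange's argument for a ^ q ≈ a runs over the whole of F
  -- rather than over its units.
  ν : Carrier → Carrier
  ν x with x ≟ 0#
  ... | yes _ = 1#
  ... | no  _ = x

  ζ : Carrier → Carrier → Carrier
  ζ a x with x ≟ 0#
  ... | yes _ = a
  ... | no  _ = 1#

  ν-nonzero : ∀ x → ν x ≉ 0#
  ν-nonzero x with x ≟ 0#
  ... | yes _   = 1≉0
  ... | no  x≉0 = x≉0

  ν-*-ζ : ∀ {a x y} → a ≉ 0# → y ≈ a * x → ν y * ζ a x ≈ a * ν x
  ν-*-ζ {a} {x} {y} a≉0 y≈ax with y ≟ 0# | x ≟ 0#
  ... | yes _   | yes _   = trans (*-identityˡ a) (sym (*-identityʳ a))
  ... | yes y≈0 | no  x≉0 = contradiction (trans (sym y≈ax) y≈0) (*-nonzero a≉0 x≉0)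
  ... | no  y≉0 | yes x≈0 = contradiction (trans y≈ax (trans (*-congˡ x≈0) (zeroʳ a))) y≉0
  ... | no  _   | no  _   = trans (*-identityʳ y) y≈ax

  ∏-ζ : ∀ a → ∏ (ζ a ∘ enum) ≈ a
  ∏-ζ a = trans (∏-singleton (ζ a ∘ enum) (index 0#) ζ≈1) (ζ≈a (enum (index 0#)) (enum-index 0#))
    where
    ζ≈a : ∀ x → x ≈ 0# → ζ a x ≈ a
    ζ≈a x x≈0 with x ≟ 0#
    ... | yes _   = refl
    ... | no  x≉0 = contradiction x≈0 x≉0
    ζ≈1 : ∀ t → t ≢ index 0# → ζ a (enum t) ≈ 1#
    ζ≈1 t t≢i0 with enum t ≟ 0#
    ... | yes et≈0 = contradiction (enum-injective _ _ (trans et≈0 (sym (enum-index 0#)))) t≢i0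
    ... | no  _    = refl

  fermat : ∀ a → a ^ q ≈ a
  fermat a with a ≟ 0#
  ... | yes a≈0 = a^[1+n]≈a (index 0#)
    where
    a^[1+n]≈a : ∀ {n} → Fin n → a ^ n ≈ a
    a^[1+n]≈a {suc n} _ = trans (*-congʳ a≈0) (trans (zeroˡ _) (sym a≈0))
  ... | no  a≉0 = sym (*-cancelˡ (∏-nonzero (ν ∘ enum) (ν-nonzero ∘ enum)) (begin
    ∏ (ν ∘ enum) * a                         ≈⟨ *-cong (∏-permute-injective (ν ∘ enum) π-injective) (∏-ζ a) ⟨
    ∏ (ν ∘ enum ∘ π) * ∏ (ζ a ∘ enum)        ≈⟨ ∏-distrib-∙ (ν ∘ enum ∘ π) (ζ a ∘ enum) ⟨
    ∏ (λ t → ν (enum (π t)) * ζ a (enum t))  ≈⟨ ∏-cong (λ t → ν-*-ζ a≉0 (enum-index (a * enum t))) ⟩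
    ∏ (λ t → a * ν (enum t))                 ≈⟨ ∏-distrib-∙ (λ _ → a) (ν ∘ enum) ⟩
    ∏ {q} (λ _ → a) * ∏ (ν ∘ enum)           ≈⟨ *-congʳ (∏-replicate q) ⟩
    a ^ q * ∏ (ν ∘ enum)                     ≈⟨ *-comm _ _ ⟩
    ∏ (ν ∘ enum) * a ^ q                     ∎))
    where
    π : Fin q → Fin q
    π t = index (a * enum t)
    π-injective : ∀ {s t} → π s ≡ π t → s ≡ t
    π-injective {s} {t} πs≡πt = enum-injective s t (*-cancelˡ a≉0 (index-injective πs≡πt))

module FiniteFieldPolynomials {c ℓ} (F : CommutativeRing c ℓ) (isField : Over.IsField F)
                              {q : ℕ} (hasSize : Over.HasSize F q) where
  open Over F hiding (zero)
  open HasSize hasSize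
  open FiniteField F isField hasSize
  open Polynomials F
  open RootFactors F isField
  open import Algebra.Properties.Semiring.Exp semiring using (_^_; ^-congˡ)

  X^q-X-vanishes : ∀ s → eval (XP ^P q -P XP) s ≈ 0#
  X^q-X-vanishes s = begin
    eval (XP ^P q +P negP XP) s          ≈⟨ eval-+P (XP ^P q) (negP XP) s ⟩
    eval (XP ^P q) s + eval (negP XP) s  ≈⟨ +-cong (eval-^P XP q s) (eval-negP XP s) ⟩
    eval XP s ^ q - eval XP s            ≈⟨ +-cong (trans (^-congˡ q (eval-XP s)) (fermat s)) (-‿cong (eval-XP s)) ⟩
    s - s                                ≈⟨ -‿inverseʳ s ⟩
    0#                                   ∎
    where open import Relation.Binary.Reasoning.Setoid setoid

  ∏-X+-∣-X^q-X : ∏P.∏ (X+_ ∘ enum) ∏P.∣ʳ XP ^P q -P XP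
  ∏-X+-∣-X^q-X = ∏-X+-∣ enum (enum-injective _ _) (XP ^P q -P XP) (X^q-X-vanishes ∘ -_ ∘ enum)

  -- φ separates the indices with equal values of r, so that r takes each value
  -- at most q times.
  ∏-X+-∣-[X^q-X]^q : ∀ {n} (φ r : Fin n → Carrier) → (∀ {i j} → φ i ≈ φ j → r i ≈ r j → i ≡ j) →
                     ∏P n (X+_ ∘ r) ∣P (XP ^P q -P XP) ^P q
  ∏-X+-∣-[X^q-X]^q {n} φ r separates = ∏-∣ʳ⇒∏P-∣P (X+_ ∘ r) (begin
    ∏P.∏ (X+_ ∘ r)                                      ≈⟨ ∏P.∏-cong g∘ι≋X+∘r ⟨
    ∏P.∏ (g ∘ ι)                                        ≲⟨ ∏P.∏-∘-injective-∣ g ι-injective ⟩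
    ∏P.∏ g                                              ≈⟨ ∏P.∏-combine q g ⟩
    ∏P.∏ {q} (λ c → ∏P.∏ {q} (λ t → g (combine c t)))
      ≈⟨ ∏P.∏-cong {q} (λ c → ∏P.∏-cong {q} (≋-reflexive ∘ g∘combine c)) ⟩
    ∏P.∏ {q} (λ _ → ∏P.∏ (X+_ ∘ enum))                  ≲⟨ ∏P.∏-cong-∣ {q} (λ _ → ∏-X+-∣-X^q-X) ⟩
    ∏P.∏ {q} (λ _ → XP ^P q -P XP)                      ≈⟨ ^P≋∏ (XP ^P q -P XP) q ⟨
    (XP ^P q -P XP) ^P q                                ∎)
    where
    open import Relation.Binary.Reasoning.Preorder ∏P.∣ʳ-preorder
    g : Fin (q ℕ.* q) → Pol
    g k = X+ enum (proj₂ (remQuot {q} q k))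
    g∘combine : ∀ c t → g (combine c t) ≡ X+ enum t
    g∘combine c t = ≡.cong (X+_ ∘ enum ∘ proj₂) (remQuot-combine c t)
    ι : Fin n → Fin (q ℕ.* q)
    ι i = combine (index (φ i)) (index (r i))
    ι-injective : ∀ {i j} → ι i ≡ ι j → i ≡ j
    ι-injective ιi≡ιj with iφ≡ , ir≡ ← combine-injective _ _ _ _ ιi≡ιj =
      separates (index-injective iφ≡) (index-injective ir≡)
    g∘ι≋X+∘r : ∀ i → g (ι i) ≋ X+ r i
    g∘ι≋X+∘r i = ≋-trans (≋-reflexive (g∘combine _ _)) (X+-cong (enum-index (r i)))

open import Data.Nat using (_^_; _∸_; _%_; _≥_)
open import Data.Nat.Primality using (Prime)

mainTheorem2 : ∀ {c ℓ} (F : CommutativeRing c ℓ) → let open Over F in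
    (p h q : ℕ) → Prime p → p % 2 ≡ 1 → h ≥ 1 → q ≡ p ^ h →
    IsField → HasSize q →
    (C : Conic) →
    (a b c' : Fin (q ^ 2 ∸ 2) → Carrier) →
    (∀ i j → i ≢ j → ¬ ((a i ≈ a j) × (b i ≈ b j) × (c' i ≈ c' j))) →
    (∀ i j → i ≢ j → ¬ OnConic C (a i - a j) (b i - b j) (c' i - c' j)) →
    (y z w : Carrier) → NonZero3 y z w →
    LineMeetsConic C y z w →
    ∏P (q ^ 2 ∸ 2) (λ i → (a i * y + b i * z + c' i * w) ∷ 1# ∷ [])
    ∣P ((XP ^P q -P XP) ^P q)
mainTheorem2 F _ _ q _ _ _ _ isField hasSize C a b c' distinct secant-free y z w n≢0
             (x₀ , x₁ , x₂ , (x≢0 , Qx≈0) , n·x≈0) =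
  ∏-X+-∣-[X^q-X]^q (λ i → P i · (x ⨯ e)) (λ i → P i · n)
    (labels-injective C P distinct secant-free f Qx≈0 n·x≈0 e·n≉0 f·x≉0)
  where
  open Over F
  open Coordinates rawRing
  open ConicGeometry F isField
  open FiniteField F isField hasSize
  open FiniteFieldPolynomials F isField hasSize
  n x : Triple
  n = y , z , w
  x = x₀ , x₁ , x₂
  P : Fin (q ^ 2 ∸ 2) → Triple
  P i = a i , b i , c' i
  e f : Triple
  e = proj₁ (∃-·-nonzero n≢0)
  f = proj₁ (∃-·-nonzero x≢0)
  e·n≉0 : ¬ e · n ≈ 0#
  e·n≉0 = proj₂ (∃-·-nonzero n≢0)
  f·x≉0 : ¬ f · x ≈ 0#
  f·x≉0 = proj₂ (∃-·-nonzero x≢0)
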